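{- Let $F :\subseteq \mathrm{Reg} \times \mathrm{Reg} \to \mathrm{Reg}$ be computed by an oracle Turing machine whose running time is bounded by a second-order polynomial $P$ (the pair $(\psi,\varphi)$ being supplied as the oracle $\langle \psi, \varphi\rangle$). Then there is no $\psi \in \mathrm{Reg}$ such that $F(\psi, \varphi) = \Phi_{\deg(P)+1}(\varphi)$ for all $\varphi \in \mathrm{Reg}$.
   Context: Fix a finite alphabet $\Sigma$. A total function $\varphi:\Sigma^*\to\Sigma^*$ is regular if $|u|\le|v|$ implies $|\varphi(u)|\le|\varphi(v)|$; its size $|\varphi|:\mathbb{N}\to\mathbb{N}$ is defined by $|\varphi|(|u|)=|\varphi(u)|$. Let $\mathrm{mon}$ be the set of strictly monotone functions $\mathbb{N}\to\mathbb{N}$ and $\mathrm{Reg}$ the set of regular $\varphi$ with $|\varphi|\in\mathrm{mon}$. A polynomial-time pairing $\langle\cdot,\cdot\rangle:\Sigma^*\times\Sigma^*\to\Sigma^*$ with $|\langle u,v\rangle|=|u|\cdot|v|$ is fixed and lifted to $\mathrm{Reg}$ by $\langle\varphi,\psi\rangle(u)=\langle\varphi(u),\psi(u)\rangle$. Second-order polynomials (in a type-1 variable $\mathtt{L}$ and a type-0 variable $\mathtt{n}$) are defined inductively: every positive integer and $\mathtt{n}$ are second-order polynomials, and if $P,Q$ are, so are $P+Q$, $P\cdot Q$ and $\mathtt{L}(P)$. A second-order polynomial $P$ defines a map $p\mapsto P(p)$ from $\mathrm{mon}$ to functions $\mathbb{N}\to\mathbb{N}$ by interpreting $\mathtt{L}$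 as $p$. An oracle Turing machine computes $F:\subseteq\mathrm{Reg}\to\mathrm{Reg}$ if for each $\varphi\in\mathrm{dom}F$ and string $u$ it outputs $F(\varphi)(u)$ on oracle $\varphi$ and input $u$; its running time is bounded by $P$ if on every oracle $\varphi\in\mathrm{Reg}$ and input $u$ it halts within $P(|\varphi|)(|u|)$ steps. The second-order degree $\deg$ is defined together with an auxiliary type in $\{\mathbf{a},\mathbf{m}\}$: $\deg(1)=\deg(\mathtt{n})=0$ (any positive integer constant likewise), both of type $\mathbf{m}$; $\deg(\mathtt{L}(P))=\deg(P)+1$, of type $\mathbf{a}$; for $P+Q$ and $P\cdot Q$ let $d=\max\{\deg P,\deg Q\}$ and say the pair is "critical" if $P$ has type $\mathbf{a}$ and $\deg P=d$, or $Q$ has type $\mathbf{a}$ and $\deg Q=d$; then $\deg(P+Q)=d$ with type $\mathbf{a}$ if critical and $\mathbf{m}$ otherwise; $\deg(P\cdot Q)=d+1$ if critical and $d$ otherwise, and $P\cdot Q$ always has type $\mathbf{m}$. Define $\Phi_n:\mathrm{Reg}\to\mathrm{Reg}$ by $\Phi_0(\varphi)(w)=w$ and $\Phi_{n+1}(\varphi)(w)=\varphi(\Phi_n(\varphi)(w))$. -}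

module Defs where

open import Data.Nat using (ℕ; zero; suc; _+_; _*_; _≤_; _<_; _⊔_; _≡ᵇ_; NonZero)
open import Data.Fin using (Fin; zero; suc; _≟_)
open import Data.List using (List; []; _∷_; length; map; replicate)
open import Data.Vec using (Vec; []; _∷_; lookup; zipWith; updateAt)
import Data.Vec as V
open import Data.Maybe using (Maybe; just; nothing)
open import Data.Sum using (_⊎_; inj₁; inj₂)
open import Data.Product using (Σ; _×_; _,_; proj₁; proj₂)
open import Data.Bool using (Bool; true; false; if_then_else_; _∧_; _∨_)
open import Relation.Nullary using (yes; no)
open import Relation.Binary.PropositionalEquality using (_≡_)

Str : ℕ → Set
Str k = List (Fin (suc k))

IsRegular : ∀ {k} → (Str k → Str k) → Set
IsRegular φ = ∀ u v → length u ≤ length v → length (φ u) ≤ length (φ v)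

Mon : (ℕ → ℕ) → Set
Mon p = ∀ m n → m < n → p m < p n

-- size |φ| : |φ|(n) = |φ(u)| for any u with |u| = n (well defined for
-- regular φ); we evaluate it on the word 0ⁿ
size : ∀ {k} → (Str k → Str k) → ℕ → ℕ
size φ n = length (φ (replicate n zero))

record Reg (k : ℕ) : Set where
  constructor mkReg
  field
    fun      : Str k → Str k
    regular  : IsRegular fun
    monotone : Mon (size fun)
open Reg public

IsLengthPairing : ∀ {k} → (Str k → Str k → Str k) → Set
IsLengthPairing {k} pair = ∀ (u v : Str k) → length (pair u v) ≡ length u * length v

liftPair : ∀ {k} → (Str k → Str k → Str k) → (Str k → Str k) → (Str k → Str k) → Str k → Str k
liftPair pair ψ φ u = pair (ψ u) (φ u)

Φ : ∀ {k} → ℕ → (Str k → Str k) → Str k → Str k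
Φ zero    φ w = w
Φ (suc n) φ w = φ (Φ n φ w)

data SOP : Set where
  con : (c : ℕ) → .{{NonZero c}} → SOP
  var : SOP
  _⊕_ : SOP → SOP → SOP
  _⊗_ : SOP → SOP → SOP
  L   : SOP → SOP

⟦_⟧ : SOP → (ℕ → ℕ) → ℕ → ℕ
⟦ con c ⟧ p n = c
⟦ var ⟧   p n = n
⟦ P ⊕ Q ⟧ p n = ⟦ P ⟧ p n + ⟦ Q ⟧ p n
⟦ P ⊗ Q ⟧ p n = ⟦ P ⟧ p n * ⟦ Q ⟧ p n
⟦ L P ⟧   p n = p (⟦ P ⟧ p n)

data DegTy : Set where
  tyA tyM : DegTy

isA : DegTy → Bool
isA tyA = true
isA tyM = false

degTy : SOP → ℕ × DegTy
degTy (con c) = 0 , tyM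
degTy var     = 0 , tyM
degTy (L P)   = suc (proj₁ (degTy P)) , tyA
degTy (P ⊕ Q) with degTy P | degTy Q
... | dp , tp | dq , tq =
  let d    = dp ⊔ dq
      crit = (isA tp ∧ (dp ≡ᵇ d)) ∨ (isA tq ∧ (dq ≡ᵇ d))
  in d , (if crit then tyA else tyM)
degTy (P ⊗ Q) with degTy P | degTy Q
... | dp , tp | dq , tq =
  let d    = dp ⊔ dq
      crit = (isA tp ∧ (dp ≡ᵇ d)) ∨ (isA tq ∧ (dq ≡ᵇ d))
  in (if crit then suc d else d) , tyM

deg : SOP → ℕ
deg P = proj₁ (degTy P)

-- Oracle Turing machines
-- Tape symbols: blank (nothing), input letters (inj₁), extra work symbols (inj₂).

Sym : ℕ → ℕ → Set
Sym k e = Maybe (Fin (suc k) ⊎ Fin e)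

data Move : Set where
  left right stay : Move

-- a two-way infinite tape as a zipper; cells not listed are blank (nothing)
record Tape (k e : ℕ) : Set where
  constructor tape
  field
    lefts  : List (Sym k e)   -- cells left of the head, nearest first
    here   : Sym k e
    rights : List (Sym k e)   -- cells right of the head, nearest first

blankTape : ∀ {k e} → Tape k e
blankTape = tape [] nothing []

fromList : ∀ {k e} → List (Sym k e) → Tape k e
fromList []       = tape [] nothing []
fromList (a ∷ as) = tape [] a as

cell : ∀ {k e} → Tape k e → Sym k e
cell = Tape.here

writeMove : ∀ {k e} → Sym k e × Move → Tape k e → Tape k e
writeMove (c , left)  (tape []       _ rs) = tape [] nothing (c ∷ rs)
writeMove (c , left)  (tape (l ∷ ls) _ rs) = tape ls l (c ∷ rs)
writeMove (c , right) (tape ls _ [])       = tape (c ∷ ls) nothing []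
writeMove (c , right) (tape ls _ (r ∷ rs)) = tape (c ∷ ls) r rs
writeMove (c , stay)  (tape ls _ rs)       = tape ls c rs

-- the word written on a tape: the maximal Σ-word starting at the head
wordFrom : ∀ {k e} → List (Sym k e) → Str k
wordFrom []                  = []
wordFrom (just (inj₁ a) ∷ s) = a ∷ wordFrom s
wordFrom (_ ∷ s)             = []

content : ∀ {k e} → Tape k e → Str k
content t = wordFrom (cell t ∷ Tape.rights t)

encode : ∀ {k e} → Str k → List (Sym k e)
encode = map (λ a → just (inj₁ a))

-- Tapes: 0 = input, 1 = oracle query, 2 = oracle answer, 3 = output,
-- 4 … 3+nwork = work tapes.
record OTM (k : ℕ) : Set where
  field
    extra   : ℕ
    nstates : ℕ
    nwork   : ℕ
    start halt query answer : Fin nstates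
    δ : Fin nstates → Vec (Sym k extra) (4 + nwork)
        → Fin nstates × Vec (Sym k extra × Move) (4 + nwork)

module _ {k : ℕ} (M : OTM k) where
  open OTM M

  Config : Set
  Config = Fin nstates × Vec (Tape k extra) (4 + nwork)

  initConfig : Str k → Config
  initConfig u = start , (fromList (encode u) ∷ V.replicate _ blankTape)

  -- one step with oracle χ: a query (entering the query state) costs one
  -- step, replaces the answer tape by χ(query) with head on its first cell,
  -- and moves to the answer state.
  step : (Str k → Str k) → Config → Config
  step χ (q , ts) with q ≟ halt
  ... | yes _ = q , ts
  ... | no _ with q ≟ query
  ...   | yes _ = answer , updateAt ts (suc (suc zero))
                    (λ _ → fromList (encode (χ (content (lookup ts (suc zero))))))
  ...   | no _ with δ q (V.map cell ts)
  ...     | q' , acts = q' , zipWith writeMove acts ts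

  run : (Str k → Str k) → Str k → ℕ → Config
  run χ u zero    = initConfig u
  run χ u (suc t) = step χ (run χ u t)

  HaltsWithin : (Str k → Str k) → Str k → ℕ → Set
  HaltsWithin χ u t = proj₁ (run χ u t) ≡ halt

  outputAt : (Str k → Str k) → Str k → ℕ → Str k
  outputAt χ u t = content (lookup (proj₂ (run χ u t)) (suc (suc (suc zero))))

  TimeBoundedBy : SOP → Set
  TimeBoundedBy P = ∀ (χ : Reg k) (u : Str k) →
    HaltsWithin (fun χ) u (⟦ P ⟧ (size (fun χ)) (length u))

  Computes₂ : (pair : Str k → Str k → Str k)
            → (Dom : Reg k → Reg k → Set)
            → (F : (ψ φ : Reg k) → Dom ψ φ → Reg k) → Set
  Computes₂ pair Dom F = ∀ ψ φ (d : Dom ψ φ) (u : Str k) →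
    Σ ℕ λ t → HaltsWithin (liftPair pair (fun ψ) (fun φ)) u t
            × outputAt (liftPair pair (fun ψ) (fun φ)) u t ≡ fun (F ψ φ d) u

module Submission where

-- Given ψ with g = |ψ|, feed F the padding oracle φ(u) = 0^{f(|u|)}, where f(m) = 2^2^(g(m) + s)
-- and 2^s bounds the constants of P. Then |⟨ψ,φ⟩| = g·f ≤ f², and f grows so fast that
-- f(z)² ≤ f(z²): a product of two values below f^d(2^c) stays below f^d(2^(2c)), so only L
-- raises the number of f's needed. By induction P(|⟨ψ,φ⟩|)(0) ≤ f^{deg P}(2^s) < f^{deg P + 1}(0),
-- which is the length of Φ_{deg P + 1}(φ)(ε). But a machine writes at most one output symbol per
-- step, so its output is no longer than its running time. (Below, f^d(x) is written fold x f d.)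

open import Defs
open import Data.Nat using (ℕ; zero; suc; _+_; _*_; _∸_; _^_; _⊔_; _≤_; _<_; z≤n; s≤s)
open import Data.Nat.Properties hiding (_≟_)
open import Data.Nat.GeneralisedArithmetic using (fold; fold-+)
open import Data.Nat.ListAction using (sum)
open import Algebra.Properties.CommutativeSemigroup +-commutativeSemigroup
  using (x∙yz≈yx∙z; xy∙z≈y∙xz)
open import Data.Bool using (true; false; if_then_else_)
open import Data.Fin using (Fin; zero; suc; _≟_)
open import Data.List using (List; []; _∷_; length; map; replicate)
open import Data.List.Properties using (length-replicate)
open import Data.Maybe using (just; nothing)
open import Data.Product using (Σ; _×_; _,_; proj₁; proj₂)
open import Data.Sum using (inj₁; inj₂)
open import Data.Vec using (lookup)
import Data.Vec as V
open import Data.Vec.Properties using (lookup∘updateAt′; lookup-zipWith)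
open import Relation.Nullary using (¬_; yes; no; contradiction)
open import Relation.Binary.PropositionalEquality
  using (_≡_; refl; sym; trans; cong; subst; subst₂; module ≡-Reasoning)

n<2^n : ∀ n → n < 2 ^ n
n<2^n zero    = s≤s z≤n
n<2^n (suc n) = +-mono-≤-< (m^n>0 2 n) (subst (n <_) (sym (+-identityʳ (2 ^ n))) (n<2^n n))

m+m≤m*m : ∀ {m} → 2 ≤ m → m + m ≤ m * m
m+m≤m*m {m} 2≤m = subst (_≤ m * m) (cong (m +_) (+-identityʳ m)) (*-monoˡ-≤ m 2≤m)

2^2^-square : ∀ {a b} → a < b → 2 ^ 2 ^ a * 2 ^ 2 ^ a ≤ 2 ^ 2 ^ b
2^2^-square {a} {b} a<b = begin
  2 ^ 2 ^ a * 2 ^ 2 ^ a  ≡⟨ ^-distribˡ-+-* 2 (2 ^ a) (2 ^ a) ⟨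
  2 ^ (2 ^ a + 2 ^ a)    ≡⟨ cong (λ e → 2 ^ (2 ^ a + e)) (+-identityʳ (2 ^ a)) ⟨
  2 ^ 2 ^ suc a          ≤⟨ ^-monoʳ-≤ 2 (^-monoʳ-≤ 2 a<b) ⟩
  2 ^ 2 ^ b              ∎
  where open ≤-Reasoning

Mon⇒monotone : ∀ {h} → Mon h → ∀ {a b} → a ≤ b → h a ≤ h b
Mon⇒monotone h-mon {a} {b} a≤b with m≤n⇒m<n∨m≡n a≤b
... | inj₁ a<b  = <⇒≤ (h-mon a b a<b)
... | inj₂ refl = ≤-refl

Mon⇒inflationary : ∀ {h} → Mon h → ∀ x → x ≤ h x
Mon⇒inflationary h-mon zero    = z≤n
Mon⇒inflationary h-mon (suc x) = ≤-<-trans (Mon⇒inflationary h-mon x) (h-mon x (suc x) ≤-refl)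

fold-suc : ∀ {A : Set} (f : A → A) x d → fold (f x) f d ≡ fold x f (suc d)
fold-suc f x d = trans (sym (fold-+ x f d)) (cong (fold x f) (+-comm d 1))

module Iterate {f : ℕ → ℕ} (f-mon : Mon f) where

  fold-mono-< : ∀ d {a b} → a < b → fold a f d < fold b f d
  fold-mono-< zero    a<b = a<b
  fold-mono-< (suc d) a<b = f-mon _ _ (fold-mono-< d a<b)

  fold-mono-≤ : ∀ d {a b} → a ≤ b → fold a f d ≤ fold b f d
  fold-mono-≤ zero    a≤b = a≤b
  fold-mono-≤ (suc d) a≤b = Mon⇒monotone f-mon (fold-mono-≤ d a≤b)

  fold-inflationary : ∀ d x → x ≤ fold x f d
  fold-inflationary zero    x = ≤-refl
  fold-inflationary (suc d) x = ≤-trans (fold-inflationary d x) (Mon⇒inflationary f-mon _)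

  fold-monoʳ-≤ : ∀ x {d e} → d ≤ e → fold x f d ≤ fold x f e
  fold-monoʳ-≤ x {zero}  {e}     _         = fold-inflationary e x
  fold-monoʳ-≤ x {suc d} {suc e} (s≤s d≤e) = Mon⇒monotone f-mon (fold-monoʳ-≤ x d≤e)

  fold-square : (∀ z → 2 ≤ z → f z * f z ≤ f (z * z)) →
                ∀ d {y} → 2 ≤ y → fold y f d * fold y f d ≤ fold (y * y) f d
  fold-square f-square zero    2≤y = ≤-refl
  fold-square f-square (suc d) 2≤y =
    ≤-trans (f-square _ (≤-trans 2≤y (fold-inflationary d _)))
            (Mon⇒monotone f-mon (fold-square f-square d 2≤y))

-- Growth of second-order polynomials

if-suc-≥ : ∀ b n → n ≤ (if b then suc n else n)
if-suc-≥ true  n = n≤1+n n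
if-suc-≥ false n = ≤-refl

deg-⊕ : ∀ P Q → deg P ⊔ deg Q ≤ deg (P ⊕ Q)
deg-⊕ P Q with degTy P | degTy Q
... | _ , _ | _ , _ = ≤-refl

deg-⊗ : ∀ P Q → deg P ⊔ deg Q ≤ deg (P ⊗ Q)
deg-⊗ P Q with degTy P | degTy Q
... | _ , _ | _ , _ = if-suc-≥ _ _

⟦⟧-mono : ∀ P {p p'} n → (∀ m → p m ≤ p' m) → (∀ {a b} → a ≤ b → p' a ≤ p' b) →
          ⟦ P ⟧ p n ≤ ⟦ P ⟧ p' n
⟦⟧-mono (con c) n p≤p' p'-mono = ≤-refl
⟦⟧-mono var     n p≤p' p'-mono = ≤-refl
⟦⟧-mono (P ⊕ Q) n p≤p' p'-mono = +-mono-≤ (⟦⟧-mono P n p≤p' p'-mono) (⟦⟧-mono Q n p≤p' p'-mono)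
⟦⟧-mono (P ⊗ Q) n p≤p' p'-mono = *-mono-≤ (⟦⟧-mono P n p≤p' p'-mono) (⟦⟧-mono Q n p≤p' p'-mono)
⟦⟧-mono (L P)   n p≤p' p'-mono = ≤-trans (p≤p' _) (p'-mono (⟦⟧-mono P n p≤p' p'-mono))

-- 2 ^ width n P bounds the value of P at n once L is read as f²; every operation squares the bound.
width : ℕ → SOP → ℕ
width n (con c) = suc c
width n var     = suc n
width n (P ⊕ Q) = (width n P ⊔ width n Q) + (width n P ⊔ width n Q)
width n (P ⊗ Q) = (width n P ⊔ width n Q) + (width n P ⊔ width n Q)
width n (L P)   = width n P + width n P

width-positive : ∀ n P → 1 ≤ width n P
width-positive n (con c) = s≤s z≤n
width-positive n var     = s≤s z≤n
width-positive n (P ⊕ Q) = ≤-trans (≤-trans (width-positive n P) (m≤m⊔n _ _)) (m≤m+n _ _)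
width-positive n (P ⊗ Q) = ≤-trans (≤-trans (width-positive n P) (m≤m⊔n _ _)) (m≤m+n _ _)
width-positive n (L P)   = ≤-trans (width-positive n P) (m≤m+n _ _)

binary-width-positive : ∀ n P Q → 1 ≤ width n P ⊔ width n Q
binary-width-positive n P Q = ≤-trans (width-positive n P) (m≤m⊔n _ _)

module PolynomialBound {f : ℕ → ℕ} (f-mon : Mon f)
                       (f-square : ∀ z → 2 ≤ z → f z * f z ≤ f (z * z)) where
  open Iterate f-mon

  f² : ℕ → ℕ
  f² m = f m * f m

  f²-mono : ∀ {a b} → a ≤ b → f² a ≤ f² b
  f²-mono a≤b = *-mono-≤ (Mon⇒monotone f-mon a≤b) (Mon⇒monotone f-mon a≤b)

  level : ℕ → ℕ → ℕ
  level d c = fold (2 ^ c) f d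

  level-≥2 : ∀ d {c} → 1 ≤ c → 2 ≤ level d c
  level-≥2 d {suc c} _ = ≤-trans (*-monoʳ-≤ 2 (m^n>0 2 c)) (fold-inflationary d _)

  level-mono : ∀ d c {d' c'} → d ≤ d' → c ≤ c' → level d c ≤ level d' c'
  level-mono d c {d'} d≤d' c≤c' =
    ≤-trans (fold-monoʳ-≤ _ d≤d') (fold-mono-≤ d' (^-monoʳ-≤ 2 c≤c'))

  level-square : ∀ d {c} → 1 ≤ c → level d c * level d c ≤ level d (c + c)
  level-square d {c} 1≤c =
    subst (λ z → level d c * level d c ≤ fold z f d) (sym (^-distribˡ-+-* 2 c c))
          (fold-square f-square d (level-≥2 0 1≤c))

  mutual
    ⟦⟧-bound : ∀ n P → ⟦ P ⟧ f² n ≤ level (deg P) (width n P)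
    ⟦⟧-bound n (con c) = <⇒≤ (≤-<-trans (n≤1+n c) (n<2^n (suc c)))
    ⟦⟧-bound n var     = <⇒≤ (≤-<-trans (n≤1+n n) (n<2^n (suc n)))
    ⟦⟧-bound n (P ⊕ Q) with operands-bound n P Q (deg-⊕ P Q)
    ... | a≤Y , b≤Y = ≤-trans (+-mono-≤ a≤Y b≤Y)
                        (≤-trans (m+m≤m*m (level-≥2 (deg (P ⊕ Q)) (binary-width-positive n P Q)))
                                 (level-square (deg (P ⊕ Q)) (binary-width-positive n P Q)))
    ⟦⟧-bound n (P ⊗ Q) with operands-bound n P Q (deg-⊗ P Q)
    ... | a≤Y , b≤Y = ≤-trans (*-mono-≤ a≤Y b≤Y)
                                (level-square (deg (P ⊗ Q)) (binary-width-positive n P Q))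
    ⟦⟧-bound n (L P) = begin
      f² (⟦ P ⟧ f² n)   ≤⟨ f²-mono (⟦⟧-bound n P) ⟩
      f² A              ≤⟨ f-square A (level-≥2 (deg P) (width-positive n P)) ⟩
      f (A * A)         ≤⟨ Mon⇒monotone f-mon (level-square (deg P) (width-positive n P)) ⟩
      level (deg (L P)) (width n (L P)) ∎
      where
      open ≤-Reasoning
      A : ℕ
      A = level (deg P) (width n P)

    operands-bound : ∀ n P Q {D} → deg P ⊔ deg Q ≤ D →
                     ⟦ P ⟧ f² n ≤ level D (width n P ⊔ width n Q) ×
                     ⟦ Q ⟧ f² n ≤ level D (width n P ⊔ width n Q)
    operands-bound n P Q D≥ =
      ≤-trans (⟦⟧-bound n P)
              (level-mono (deg P) (width n P) (≤-trans (m≤m⊔n _ _) D≥) (m≤m⊔n _ _)) ,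
      ≤-trans (⟦⟧-bound n Q)
              (level-mono (deg Q) (width n Q) (≤-trans (m≤n⊔m _ _) D≥) (m≤n⊔m (width n P) _))

-- Output length of oracle machines

mark : ∀ {k e} → Sym k e → ℕ
mark nothing  = 0
mark (just _) = 1

marks : ∀ {k e} → List (Sym k e) → ℕ
marks cs = sum (map mark cs)

nonBlanks : ∀ {k e} → Tape k e → ℕ
nonBlanks (tape ls h rs) = marks ls + (mark h + marks rs)

mark≤1 : ∀ {k e} (c : Sym k e) → mark c ≤ 1
mark≤1 nothing  = z≤n
mark≤1 (just _) = ≤-refl

length-wordFrom : ∀ {k e} (cs : List (Sym k e)) → length (wordFrom cs) ≤ marks cs
length-wordFrom []                  = z≤n
length-wordFrom (just (inj₁ a) ∷ s) = s≤s (length-wordFrom s)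
length-wordFrom (just (inj₂ a) ∷ s) = z≤n
length-wordFrom (nothing ∷ s)       = z≤n

length-content : ∀ {k e} (t : Tape k e) → length (content t) ≤ nonBlanks t
length-content (tape ls h rs) = ≤-trans (length-wordFrom (h ∷ rs)) (m≤n+m _ (marks ls))

nonBlanks-writeMove : ∀ {k e} c m (t : Tape k e) →
                      nonBlanks (writeMove (c , m) t) ≡ nonBlanks (record t { here = c })
nonBlanks-writeMove c left  (tape []       _ rs) = refl
nonBlanks-writeMove c left  (tape (l ∷ ls) _ rs) = x∙yz≈yx∙z (marks ls) (mark l) (mark c + marks rs)
nonBlanks-writeMove c right (tape ls _ [])       = xy∙z≈y∙xz (mark c) (marks ls) 0
nonBlanks-writeMove c right (tape ls _ (r ∷ rs)) = xy∙z≈y∙xz (mark c) (marks ls) (mark r + marks rs)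
nonBlanks-writeMove c stay  (tape ls _ rs)       = refl

nonBlanks-overwrite : ∀ {k e} c (t : Tape k e) → nonBlanks (record t { here = c }) ≤ suc (nonBlanks t)
nonBlanks-overwrite c (tape ls h rs) =
  ≤-trans (+-monoʳ-≤ (marks ls) (+-monoˡ-≤ (marks rs) (≤-trans (mark≤1 c) (s≤s z≤n))))
          (≤-reflexive (+-suc (marks ls) (mark h + marks rs)))

nonBlanks-writeMove-≤ : ∀ {k e} a (t : Tape k e) → nonBlanks (writeMove a t) ≤ suc (nonBlanks t)
nonBlanks-writeMove-≤ (c , m) t =
  ≤-trans (≤-reflexive (nonBlanks-writeMove c m t)) (nonBlanks-overwrite c t)

module Machine {k : ℕ} (M : OTM k) where
  open OTM M

  outputIndex : Fin (4 + nwork)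
  outputIndex = suc (suc (suc zero))

  outputTape : Config M → Tape k extra
  outputTape c = lookup (proj₂ c) outputIndex

  nonBlanks-step : ∀ χ c → nonBlanks (outputTape (step M χ c)) ≤ suc (nonBlanks (outputTape c))
  nonBlanks-step χ (q , ts) with q ≟ halt
  ... | yes _ = n≤1+n _
  ... | no _ with q ≟ query
  ...   | yes _ =
    ≤-trans (≤-reflexive (cong nonBlanks (lookup∘updateAt′ outputIndex (suc (suc zero)) (λ ()) ts)))
            (n≤1+n _)
  ...   | no _ with δ q (V.map cell ts)
  ...     | _ , acts = ≤-trans (≤-reflexive (cong nonBlanks (lookup-zipWith writeMove _ acts ts)))
                               (nonBlanks-writeMove-≤ (lookup acts outputIndex) (lookup ts outputIndex))

  nonBlanks-run : ∀ χ u t → nonBlanks (outputTape (run M χ u t)) ≤ t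
  nonBlanks-run χ u zero    = z≤n
  nonBlanks-run χ u (suc t) = ≤-trans (nonBlanks-step χ (run M χ u t)) (s≤s (nonBlanks-run χ u t))

  length-outputAt : ∀ χ u t → length (outputAt M χ u t) ≤ t
  length-outputAt χ u t = ≤-trans (length-content (outputTape (run M χ u t))) (nonBlanks-run χ u t)

  step-halted : ∀ χ c → proj₁ c ≡ halt → step M χ c ≡ c
  step-halted χ (q , ts) q≡halt with q ≟ halt
  ... | yes _     = refl
  ... | no q≢halt = contradiction q≡halt q≢halt

  run-halted : ∀ χ u {t} j → HaltsWithin M χ u t → run M χ u (j + t) ≡ run M χ u t
  run-halted χ u zero    halted = refl
  run-halted χ u (suc j) halted =
    trans (cong (step M χ) (run-halted χ u j halted)) (step-halted χ _ halted)

  outputAt-halted : ∀ χ u {t s} → HaltsWithin M χ u t → t ≤ s →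
                    outputAt M χ u s ≡ outputAt M χ u t
  outputAt-halted χ u {t} {s} halted t≤s = cong (λ c → content (outputTape c)) (begin
    run M χ u s             ≡⟨ cong (run M χ u) (m∸n+n≡m t≤s) ⟨
    run M χ u (s ∸ t + t)   ≡⟨ run-halted χ u (s ∸ t) halted ⟩
    run M χ u t             ∎)
    where open ≡-Reasoning

  length-output-≤-halting-time : ∀ χ u {t s} → HaltsWithin M χ u t → HaltsWithin M χ u s →
                                 length (outputAt M χ u t) ≤ s
  length-output-≤-halting-time χ u {t} {s} t-halted s-halted with ≤-total t s
  ... | inj₁ t≤s = subst (λ w → length w ≤ s) (outputAt-halted χ u t-halted t≤s)
                         (length-outputAt χ u s)
  ... | inj₂ s≤t = subst (λ w → length w ≤ s) (sym (outputAt-halted χ u s-halted s≤t))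
                         (length-outputAt χ u s)

-- The padding oracle

tower : (ℕ → ℕ) → ℕ → ℕ → ℕ
tower g s m = 2 ^ 2 ^ (g m + s)

module Tower {g : ℕ → ℕ} (g-mon : Mon g) (s : ℕ) where

  tower-mon : Mon (tower g s)
  tower-mon a b a<b = ^-monoʳ-< 2 ≤-refl (^-monoʳ-< 2 ≤-refl (+-monoˡ-< s (g-mon a b a<b)))

  tower-square : ∀ z → 2 ≤ z → tower g s z * tower g s z ≤ tower g s (z * z)
  tower-square z@(suc _) 2≤z = 2^2^-square (+-monoˡ-< s (g-mon z (z * z) (m<m*n z z 2≤z)))

  tower-dominates : ∀ m → g m ≤ tower g s m
  tower-dominates m = <⇒≤ (≤-<-trans (m≤m+n (g m) s) (<-trans (n<2^n _) (n<2^n _)))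

  2^s<tower : ∀ m → 2 ^ s < tower g s m
  2^s<tower m = ≤-<-trans (^-monoʳ-≤ 2 (m≤n+m s (g m))) (n<2^n _)

module _ {k : ℕ} where

  zeros : ℕ → Str k
  zeros n = replicate n zero

  pad : (ℕ → ℕ) → Str k → Str k
  pad f u = zeros (f (length u))

  length-pad : ∀ f u → length (pad f u) ≡ f (length u)
  length-pad f u = length-replicate (f (length u))

  size-pad : ∀ f m → size (pad f) m ≡ f m
  size-pad f m = trans (length-pad f (zeros m)) (cong f (length-replicate m))

  padReg : (f : ℕ → ℕ) → Mon f → Reg k
  padReg f f-mon = mkReg (pad f)
    (λ u v |u|≤|v| → subst₂ _≤_ (sym (length-pad f u)) (sym (length-pad f v))
                       (Mon⇒monotone f-mon |u|≤|v|))
    (λ a b a<b → subst₂ _<_ (sym (size-pad f a)) (sym (size-pad f b)) (f-mon a b a<b))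

  module _ (pair : Str k → Str k → Str k) (pairing : IsLengthPairing pair) where

    size-liftPair : ∀ ψ φ m → size (liftPair pair ψ φ) m ≡ size ψ m * size φ m
    size-liftPair ψ φ m = pairing _ _

    pairReg : Reg k → Reg k → Reg k
    pairReg ψ φ = mkReg (liftPair pair (fun ψ) (fun φ))
      (λ u v |u|≤|v| → subst₂ _≤_ (sym (pairing (fun ψ u) (fun φ u)))
                                   (sym (pairing (fun ψ v) (fun φ v)))
                                   (*-mono-≤ (regular ψ u v |u|≤|v|) (regular φ u v |u|≤|v|)))
      (λ a b a<b → subst₂ _<_ (sym (size-liftPair (fun ψ) (fun φ) a))
                               (sym (size-liftPair (fun ψ) (fun φ) b))
                               (*-mono-< (monotone ψ a b a<b) (monotone φ a b a<b)))

  length-Φ : ∀ {φ : Str k → Str k} {f} → (∀ u → length (φ u) ≡ f (length u)) →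
             ∀ n w → length (Φ n φ w) ≡ fold (length w) f n
  length-Φ φ-length zero    w = refl
  length-Φ {f = f} φ-length (suc n) w = trans (φ-length _) (cong f (length-Φ φ-length n w))

length-output-≤-time : ∀ {k} (pair : Str k → Str k → Str k) → IsLengthPairing pair →
  (M : OTM k) (P : SOP) → TimeBoundedBy M P →
  (Dom : Reg k → Reg k → Set) (F : (ψ φ : Reg k) → Dom ψ φ → Reg k) → Computes₂ M pair Dom F →
  ∀ ψ φ d u → length (fun (F ψ φ d) u) ≤ ⟦ P ⟧ (size (liftPair pair (fun ψ) (fun φ))) (length u)
length-output-≤-time {k} pair pairing M P time Dom F computes ψ φ d u with computes ψ φ d u
... | t , halted , output≡F = subst (λ w → length w ≤ _) output≡F
        (length-output-≤-halting-time χ u {t} halted (time (pairReg pair pairing ψ φ) u))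
  where
  open Machine M
  χ : Str k → Str k
  χ = liftPair pair (fun ψ) (fun φ)

theorem14 : (k : ℕ) (pair : Str k → Str k → Str k) → IsLengthPairing pair →
    (M : OTM k) (P : SOP) → TimeBoundedBy M P →
    (Dom : Reg k → Reg k → Set) (F : (ψ φ : Reg k) → Dom ψ φ → Reg k) →
    Computes₂ M pair Dom F →
    ¬ (Σ (Reg k) λ ψ → (φ : Reg k) →
    Σ (Dom ψ φ) λ d → (w : Str k) → fun (F ψ φ d) w ≡ Φ (suc (deg P)) (fun φ) w)
theorem14 k pair pairing M P time Dom F computes (ψ , F≡Φ) = <-irrefl refl (begin-strict
  fold 0 f (suc D)              ≡⟨ length-Φ {φ = pad f} {f} (length-pad f) (suc D) [] ⟨
  length (Φ (suc D) (pad f) []) ≡⟨ cong length (proj₂ (F≡Φ φ) []) ⟨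
  length (fun (F ψ φ d) [])     ≤⟨ length-output-≤-time pair pairing M P time Dom F computes ψ φ d [] ⟩
  ⟦ P ⟧ (size χ) 0              ≤⟨ ⟦⟧-mono P 0 size-χ≤f² f²-mono ⟩
  ⟦ P ⟧ f² 0                    ≤⟨ ⟦⟧-bound 0 P ⟩
  fold (2 ^ width 0 P) f D      <⟨ fold-mono-< D (2^s<tower 0) ⟩
  fold (f 0) f D                ≡⟨ fold-suc f 0 D ⟩
  fold 0 f (suc D)              ∎)
  where
  D : ℕ
  D = deg P
  g f : ℕ → ℕ
  g = size (fun ψ)
  f = tower g (width 0 P)
  open Tower (monotone ψ) (width 0 P)
  open PolynomialBound tower-mon tower-square
  open Iterate tower-mon
  open ≤-Reasoning
  φ : Reg k
  φ = padReg f tower-mon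
  d : Dom ψ φ
  d = proj₁ (F≡Φ φ)
  χ : Str k → Str k
  χ = liftPair pair (fun ψ) (pad f)
  size-χ≤f² : ∀ m → size χ m ≤ f² m
  size-χ≤f² m = begin
    size χ m             ≡⟨ size-liftPair pair pairing (fun ψ) (pad f) m ⟩
    g m * size (pad f) m ≡⟨ cong (g m *_) (size-pad f m) ⟩
    g m * f m            ≤⟨ *-monoˡ-≤ (f m) (tower-dominates m) ⟩
    f² m                 ∎
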